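{- Let $G$ be a circulant bipartite graph and let $n\ge1$. Then $K_{n,n}\otimes G$ is a circulant graph.
   Context: $K_{n,n}$ is the complete bipartite graph with both parts of size $n$. The tensor product $G\otimes H$ has vertex set $V(G)\times V(H)$, with $(g,h)$ adjacent to $(g',h')$ iff $g$ is adjacent to $g'$ in $G$ and $h$ is adjacent to $h'$ in $H$. A graph on $N$ vertices is circulant if its vertices can be labeled by $\mathbb{Z}_N$ so that, for some set $S\subseteq\mathbb{Z}_N$ with $S=-S$, vertices $i$ and $j$ are adjacent iff $j-i\in S\pmod N$. -}

module Defs where

open import Data.Nat using (ℕ; zero; suc; _+_; _∸_; _<_)
open import Data.Nat.DivMod using (_%_)
open import Data.Fin using (Fin; toℕ)
open import Data.Sum using (_⊎_; inj₁; inj₂)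
open import Data.Product using (_×_; _,_; Σ; ∃)
open import Data.Bool using (Bool)
open import Data.Empty using (⊥)
open import Data.Unit using (⊤)
open import Relation.Binary.PropositionalEquality using (_≡_; _≢_)
open import Function.Bundles using (_↔_; _⇔_; Inverse)

record Graph : Set₁ where
  field
    V   : Set
    Adj : V → V → Set
open Graph public

diffMod : (N : ℕ) → Fin N → Fin N → ℕ
diffMod zero    ()
diffMod (suc m) i j = (suc m + toℕ j ∸ toℕ i) % suc m

-- S ⊆ ℤ_N (encoded as a predicate on ℕ, read on 0..N-1) is closed under negation.
SymmetricConnSet : (N : ℕ) → (ℕ → Set) → Set
SymmetricConnSet zero    S = ⊤   -- ℤ_0 case: Fin 0 is empty, nothing to check
SymmetricConnSet (suc m) S = ∀ k → k < suc m → S k → S ((suc m ∸ k) % suc m)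

Circulant : Graph → Set₁
Circulant G =
  Σ ℕ λ N → Σ (Fin N ↔ V G) λ f → Σ (ℕ → Set) λ S →
    SymmetricConnSet N S ×
    (∀ i j → Adj G (Inverse.to f i) (Inverse.to f j) ⇔ S (diffMod N i j))

Bipartite : Graph → Set
Bipartite G = Σ (V G → Bool) λ c → ∀ u v → Adj G u v → c u ≢ c v

KAdj : (n : ℕ) → Fin n ⊎ Fin n → Fin n ⊎ Fin n → Set
KAdj n (inj₁ _) (inj₂ _) = ⊤
KAdj n (inj₂ _) (inj₁ _) = ⊤
KAdj n (inj₁ _) (inj₁ _) = ⊥
KAdj n (inj₂ _) (inj₂ _) = ⊥

K : ℕ → Graph
K n = record { V = Fin n ⊎ Fin n ; Adj = KAdj n }

_⊗_ : Graph → Graph → Graph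
G ⊗ H = record
  { V   = V G × V H
  ; Adj = λ { (g , h) (g' , h') → Adj G g g' × Adj H h h' } }

-- Since G is bipartite with a colouring c, sending the vertex (a , g) of the b-th copy of the
-- blow-up G[n] (every vertex of G replaced by n pairwise non-adjacent twins) to the vertex a of
-- part b xor c g of K n, paired with g, identifies two disjoint copies of G[n] with K n ⊗ G:
-- adjacent vertices g , g′ of G have different colours, so b xor c g and b′ xor c g′ differ
-- exactly when b = b′. If G is circulant on ℤ_m with connection set S, then G[n] is circulant on
-- ℤ_{nm} with connection set {d : d mod m ∈ S}, and k copies of a circulant graph on ℤ_P are
-- circulant on ℤ_{kP}, the copies being the residue classes mod k, with connection set k·S.
module Submission where

open import Defs
open import Data.Nat using (ℕ; zero; suc; _+_; _*_; _∸_; _<_; _≤_; _≥_; NonZero)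
open import Data.Nat.Properties
open import Data.Nat.DivMod
open import Data.Nat.Divisibility using (_∣_; ∣-refl; n∣m*n; m∣m*n)
open import Data.Nat.Tactic.RingSolver using (solve-∀)
open import Data.Fin using (Fin; toℕ; quotient; remainder)
open import Data.Fin.Properties using (¬Fin0; toℕ<n; toℕ-injective; toℕ-combine; combine-remQuot; *↔×; 2↔Bool)
open import Data.Bool using (Bool; true; false; _xor_)
open import Data.Bool.Properties using (xor-assoc; xor-same; xor-identityʳ)
open import Data.Sum using (_⊎_; inj₁; inj₂; reduce)
open import Data.Product using (_×_; _,_; Σ; proj₁; proj₂)
open import Data.Product.Function.NonDependent.Propositional using (_×-↔_)
open import Data.Empty using (⊥; ⊥-elim)
open import Data.Unit using (tt)
open import Relation.Nullary using (¬_)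
open import Relation.Binary.PropositionalEquality
open import Function.Bundles using (_↔_; _⇔_; Inverse; Injection; Equivalence; mk↔ₛ′; mk⇔)
open import Function.Properties.Inverse using (↔-refl; ↔-trans; ↔⇒↣)
open import Function.Properties.Equivalence using () renaming (sym to ⇔-sym; trans to ⇔-trans)

[m%d+n]%d≡[m+n]%d : ∀ m n d .{{_ : NonZero d}} → (m % d + n) % d ≡ (m + n) % d
[m%d+n]%d≡[m+n]%d m n d = begin
  (m % d + n) % d           ≡⟨ %-distribˡ-+ (m % d) n d ⟩
  (m % d % d + n % d) % d   ≡⟨ cong (λ x → (x + n % d) % d) (m%n%n≡m%n m d) ⟩
  (m % d + n % d) % d       ≡⟨ %-distribˡ-+ m n d ⟨
  (m + n) % d               ∎
  where open ≡-Reasoning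

[m+n%d]%d≡[m+n]%d : ∀ m n d .{{_ : NonZero d}} → (m + n % d) % d ≡ (m + n) % d
[m+n%d]%d≡[m+n]%d m n d = begin
  (m + n % d) % d ≡⟨ %-congˡ (+-comm m (n % d)) ⟩
  (n % d + m) % d ≡⟨ [m%d+n]%d≡[m+n]%d n m d ⟩
  (n + m) % d     ≡⟨ %-congˡ (+-comm n m) ⟩
  (m + n) % d     ∎
  where open ≡-Reasoning

%-cancelʳ-+ : ∀ m n o d .{{_ : NonZero d}} → (m + o) % d ≡ (n + o) % d → m % d ≡ n % d
%-cancelʳ-+ m n o d@(suc d-1) eq = begin
  m % d                         ≡⟨ shift m ⟩
  ((m + o) % d + o * d-1) % d   ≡⟨ cong (λ x → (x + o * d-1) % d) eq ⟩
  ((n + o) % d + o * d-1) % d   ≡⟨ shift n ⟨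
  n % d                         ∎
  where
  open ≡-Reasoning
  -- x + o * d = (x + o) + o * (d - 1): undoing the shift by o is a shift by o * (d - 1)
  shift : ∀ x → x % d ≡ ((x + o) % d + o * d-1) % d
  shift x = begin
    x % d                       ≡⟨ [m+kn]%n≡m%n x o d ⟨
    (x + o * d) % d             ≡⟨ %-congˡ (trans (cong (x +_) (*-suc o d-1)) (sym (+-assoc x o (o * d-1)))) ⟩
    (x + o + o * d-1) % d       ≡⟨ [m%d+n]%d≡[m+n]%d (x + o) (o * d-1) d ⟨
    ((x + o) % d + o * d-1) % d ∎

[n∸m]%d≡[d∸m%d]%d : ∀ m n d .{{_ : NonZero d}} → d ∣ n → m ≤ n → (n ∸ m) % d ≡ (d ∸ m % d) % d
[n∸m]%d≡[d∸m%d]%d m n d@(suc _) d∣n m≤n = %-cancelʳ-+ (n ∸ m) (d ∸ m % d) m d (begin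
  (n ∸ m + m) % d             ≡⟨ %-congˡ (m∸n+n≡m m≤n) ⟩
  n % d                       ≡⟨ %-remove-+ʳ 0 d∣n ⟩
  0                           ≡⟨ n%n≡0 d ⟨
  d % d                       ≡⟨ %-congˡ (m∸n+n≡m (m%n≤n m d)) ⟨
  (d ∸ m % d + m % d) % d     ≡⟨ [m+n%d]%d≡[m+n]%d (d ∸ m % d) m d ⟩
  (d ∸ m % d + m) % d         ∎)
  where open ≡-Reasoning

diffMod<n : ∀ {n} (i j : Fin (suc n)) → diffMod (suc n) i j < suc n
diffMod<n {n} i j = m%n<n (suc n + toℕ j ∸ toℕ i) (suc n)

diffMod-+ : ∀ {n} (i j : Fin (suc n)) → (diffMod (suc n) i j + toℕ i) % suc n ≡ toℕ j
diffMod-+ {n} i j = begin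
  ((N + toℕ j ∸ toℕ i) % N + toℕ i) % N ≡⟨ [m%d+n]%d≡[m+n]%d (N + toℕ j ∸ toℕ i) (toℕ i) N ⟩
  (N + toℕ j ∸ toℕ i + toℕ i) % N       ≡⟨ %-congˡ (m∸n+n≡m (≤-trans (<⇒≤ (toℕ<n i)) (m≤m+n N (toℕ j)))) ⟩
  (N + toℕ j) % N                       ≡⟨ %-remove-+ˡ (toℕ j) (∣-refl {N}) ⟩
  toℕ j % N                             ≡⟨ m<n⇒m%n≡m (toℕ<n j) ⟩
  toℕ j                                 ∎
  where
  open ≡-Reasoning
  N : ℕ
  N = suc n

diffMod-unique : ∀ {n} (i j : Fin (suc n)) {d} → d < suc n → (d + toℕ i) % suc n ≡ toℕ j →
                 d ≡ diffMod (suc n) i j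
diffMod-unique {n} i j {d} d<n eq = begin
  d                           ≡⟨ m<n⇒m%n≡m d<n ⟨
  d % suc n                   ≡⟨ %-cancelʳ-+ d (diffMod (suc n) i j) (toℕ i) (suc n) (trans eq (sym (diffMod-+ i j))) ⟩
  diffMod (suc n) i j % suc n ≡⟨ m<n⇒m%n≡m (diffMod<n i j) ⟩
  diffMod (suc n) i j         ∎
  where open ≡-Reasoning

diffMod≡0⇒≡ : ∀ {n} {i j : Fin (suc n)} → diffMod (suc n) i j ≡ 0 → i ≡ j
diffMod≡0⇒≡ {n} {i} {j} eq = toℕ-injective (begin
  toℕ i                                 ≡⟨ m<n⇒m%n≡m (toℕ<n i) ⟨
  (0 + toℕ i) % suc n                   ≡⟨ %-congˡ (cong (_+ toℕ i) eq) ⟨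
  (diffMod (suc n) i j + toℕ i) % suc n ≡⟨ diffMod-+ i j ⟩
  toℕ j                                 ∎)
  where open ≡-Reasoning

toℕ-quotient-remainder : ∀ {n} m (i : Fin (n * m)) →
                         toℕ i ≡ m * toℕ (quotient {n} m i) + toℕ (remainder {n} m i)
toℕ-quotient-remainder {n} m i =
  trans (cong toℕ (sym (combine-remQuot {n} m i))) (toℕ-combine (quotient {n} m i) (remainder {n} m i))

toℕ-remainder : ∀ {n} m .{{_ : NonZero m}} (i : Fin (n * m)) → toℕ (remainder {n} m i) ≡ toℕ i % m
toℕ-remainder {n} m i = begin
  toℕ r                                    ≡⟨ m<n⇒m%n≡m (toℕ<n r) ⟨
  toℕ r % m                                ≡⟨ %-remove-+ˡ (toℕ r) (m∣m*n (toℕ (quotient {n} m i))) ⟨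
  (m * toℕ (quotient {n} m i) + toℕ r) % m ≡⟨ %-congˡ (toℕ-quotient-remainder m i) ⟨
  toℕ i % m                                ∎
  where
  open ≡-Reasoning
  r : Fin m
  r = remainder {n} m i

module _ {n m : ℕ} (i j : Fin (suc n * suc m)) where

  private
    N M D : ℕ
    N = suc n * suc m
    M = suc m
    D = diffMod N i j

  diffMod-remainder : D % M ≡ diffMod M (remainder {suc n} M i) (remainder {suc n} M j)
  diffMod-remainder = diffMod-unique _ _ (m%n<n D M) (begin
    (D % M + toℕ (remainder {suc n} M i)) % M ≡⟨ cong (λ x → (D % M + x) % M) (toℕ-remainder {suc n} M i) ⟩
    (D % M + toℕ i % M) % M                  ≡⟨ %-distribˡ-+ D (toℕ i) M ⟨
    (D + toℕ i) % M                          ≡⟨ m∣n⇒o%n%m≡o%m M N (D + toℕ i) (n∣m*n (suc n)) ⟨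
    (D + toℕ i) % N % M                      ≡⟨ cong (_% M) (diffMod-+ i j) ⟩
    toℕ j % M                                ≡⟨ toℕ-remainder {suc n} M j ⟨
    toℕ (remainder {suc n} M j)              ∎)
    where open ≡-Reasoning

  diffMod-quotient : remainder {suc n} M i ≡ remainder {suc n} M j →
                     D ≡ diffMod (suc n) (quotient {suc n} M i) (quotient {suc n} M j) * M
  diffMod-quotient same = sym (diffMod-unique i j (*-monoˡ-< M (diffMod<n q q′)) (begin
    (d * M + toℕ i) % N               ≡⟨ %-congˡ (cong (d * M +_) (toℕ-quotient-remainder {suc n} M i)) ⟩
    (d * M + (M * toℕ q + toℕ r)) % N ≡⟨ %-congˡ (regroup d M (toℕ q) (toℕ r)) ⟩
    ((d + toℕ q) * M + toℕ r) % N     ≡⟨ [m*n+o]%[p*n]≡[m*n]%[p*n]+o (d + toℕ q) (suc n) (toℕ<n r) ⟩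
    (d + toℕ q) * M % N + toℕ r       ≡⟨ cong (_+ toℕ r) (m%n*o≡m*o%[n*o] (d + toℕ q) (suc n) M) ⟨
    (d + toℕ q) % suc n * M + toℕ r   ≡⟨ cong (λ x → x * M + toℕ r) (diffMod-+ q q′) ⟩
    toℕ q′ * M + toℕ r                ≡⟨ cong₂ _+_ (*-comm (toℕ q′) M) (cong toℕ same) ⟩
    M * toℕ q′ + toℕ r′               ≡⟨ toℕ-quotient-remainder {suc n} M j ⟨
    toℕ j                             ∎))
    where
    open ≡-Reasoning
    q q′ : Fin (suc n)
    q = quotient {suc n} M i
    q′ = quotient {suc n} M j
    r r′ : Fin M
    r = remainder {suc n} M i
    r′ = remainder {suc n} M j
    d : ℕ
    d = diffMod (suc n) q q′
    regroup : ∀ a b c e → a * b + (b * c + e) ≡ (a + c) * b + e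
    regroup = solve-∀

record _≅_ (G H : Graph) : Set where
  field
    vertices  : V G ↔ V H
    adjacency : ∀ u v → Adj G u v ⇔ Adj H (Inverse.to vertices u) (Inverse.to vertices v)

circulant-≅ : ∀ {G H} → G ≅ H → Circulant G → Circulant H
circulant-≅ G≅H (N , f , S , S-sym , S-adj) =
  N , ↔-trans f vertices , S , S-sym , λ i j → ⇔-trans (⇔-sym (adjacency _ _)) (S-adj i j)
  where open _≅_ G≅H

empty⇒circulant : ∀ G → ¬ V G → Circulant G
empty⇒circulant _ ¬v = 0 , mk↔ₛ′ (λ ()) (λ v → ⊥-elim (¬v v)) (λ v → ⊥-elim (¬v v)) (λ ()) , (λ _ → ⊥) , tt , λ ()

Blowup : ℕ → Graph → Graph
Blowup n G = record { V = Fin n × V G ; Adj = λ u v → Adj G (proj₂ u) (proj₂ v) }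

Copies : Set → Graph → Graph
Copies I H = record { V = V H × I ; Adj = λ u v → proj₂ u ≡ proj₂ v × Adj H (proj₁ u) (proj₁ v) }

blowup-circulant : ∀ n G → Circulant G → Circulant (Blowup n G)
blowup-circulant zero G _ = empty⇒circulant (Blowup zero G) (λ v → ¬Fin0 (proj₁ v))
blowup-circulant (suc n) G (zero , f , _) = empty⇒circulant (Blowup (suc n) G) (λ v → ¬Fin0 (Inverse.from f (proj₂ v)))
blowup-circulant (suc n) G (suc m , f , S , S-sym , S-adj) =
  N , ↔-trans *↔× (↔-refl ×-↔ f) , (λ x → S (x % M)) , S′-sym , S′-adj
  where
  M N : ℕ
  M = suc m
  N = suc n * M
  M∣N : M ∣ N
  M∣N = n∣m*n (suc n)
  S′-sym : SymmetricConnSet N (λ x → S (x % M))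
  S′-sym x x<N Sx = subst S (sym (trans (m∣n⇒o%n%m≡o%m M N (N ∸ x) M∣N) ([n∸m]%d≡[d∸m%d]%d x N M M∣N (<⇒≤ x<N))))
                          (S-sym (x % M) (m%n<n x M) Sx)
  S′-adj : ∀ i j → Adj G (Inverse.to f (remainder {suc n} M i)) (Inverse.to f (remainder {suc n} M j))
                   ⇔ S (diffMod N i j % M)
  S′-adj i j = subst (λ x → Adj G (Inverse.to f r) (Inverse.to f r′) ⇔ S x)
                     (sym (diffMod-remainder {n} {m} i j)) (S-adj r r′)
    where
    r r′ : Fin M
    r = remainder {suc n} M i
    r′ = remainder {suc n} M j

copies-circulant : ∀ {k I} → Fin k ↔ I → ∀ H → Circulant H → Circulant (Copies I H)
copies-circulant {zero} {I} e H _ = empty⇒circulant (Copies I H) (λ v → ¬Fin0 (Inverse.from e (proj₂ v)))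
copies-circulant {suc k} {I} e H (zero , f , _) = empty⇒circulant (Copies I H) (λ v → ¬Fin0 (Inverse.from f (proj₁ v)))
copies-circulant {suc k} {I} e H (suc p , f , S , S-sym , S-adj) =
  N , labels , S′ , S′-sym , S′-adj
  where
  P M N : ℕ
  P = suc p
  M = suc k
  N = P * M
  S′ : ℕ → Set
  S′ x = Σ ℕ λ d → x ≡ d * M × S d
  S′-sym : SymmetricConnSet N S′
  S′-sym .(d * M) dM<N (d , refl , Sd) =
    (P ∸ d) % P ,
    trans (%-congˡ (sym (*-distribʳ-∸ M P d))) (sym (m%n*o≡m*o%[n*o] (P ∸ d) P M)) ,
    S-sym d (*-cancelʳ-< M d P dM<N) Sd
  labels : Fin N ↔ (V H × I)
  labels = ↔-trans *↔× (f ×-↔ e)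
  S′-adj : ∀ i j → Adj (Copies I H) (Inverse.to labels i) (Inverse.to labels j) ⇔ S′ (diffMod N i j)
  S′-adj i j = mk⇔ to from
    where
    q q′ : Fin P
    q = quotient {P} M i
    q′ = quotient {P} M j
    r r′ : Fin M
    r = remainder {P} M i
    r′ = remainder {P} M j
    to : Inverse.to e r ≡ Inverse.to e r′ × Adj H (Inverse.to f q) (Inverse.to f q′) → S′ (diffMod N i j)
    to (er≡er′ , adj) =
      diffMod P q q′ ,
      diffMod-quotient {p} {k} i j (Injection.injective (↔⇒↣ e) er≡er′) ,
      Equivalence.to (S-adj q q′) adj
    from : S′ (diffMod N i j) → Inverse.to e r ≡ Inverse.to e r′ × Adj H (Inverse.to f q) (Inverse.to f q′)
    from (d , D≡dM , Sd) = cong (Inverse.to e) r≡r′ , Equivalence.from (S-adj q q′) (subst S d≡ Sd)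
      where
      r≡r′ : r ≡ r′
      r≡r′ = diffMod≡0⇒≡ (trans (sym (diffMod-remainder {p} {k} i j)) (trans (%-congˡ D≡dM) (m*n%n≡0 d M)))
      d≡ : d ≡ diffMod P q q′
      d≡ = *-cancelʳ-≡ d (diffMod P q q′) M (trans (sym D≡dM) (diffMod-quotient {p} {k} i j r≡r′))

xor-cancelʳ : ∀ b x → (b xor x) xor x ≡ b
xor-cancelʳ b x = trans (xor-assoc b x x) (trans (cong (b xor_) (xor-same x)) (xor-identityʳ b))

≡⇔xor-≢ : ∀ {x x′} → x ≢ x′ → ∀ b b′ → b ≡ b′ ⇔ (b xor x ≢ b′ xor x′)
≡⇔xor-≢ {false} {false} x≢x′ = ⊥-elim (x≢x′ refl)
≡⇔xor-≢ {true}  {true}  x≢x′ = ⊥-elim (x≢x′ refl)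
≡⇔xor-≢ {false} {true}  _ false false = mk⇔ (λ _ ()) (λ _ → refl)
≡⇔xor-≢ {false} {true}  _ false true  = mk⇔ (λ ()) (λ ne → ⊥-elim (ne refl))
≡⇔xor-≢ {false} {true}  _ true  false = mk⇔ (λ ()) (λ ne → ⊥-elim (ne refl))
≡⇔xor-≢ {false} {true}  _ true  true  = mk⇔ (λ _ ()) (λ _ → refl)
≡⇔xor-≢ {true}  {false} _ false false = mk⇔ (λ _ ()) (λ _ → refl)
≡⇔xor-≢ {true}  {false} _ false true  = mk⇔ (λ ()) (λ ne → ⊥-elim (ne refl))
≡⇔xor-≢ {true}  {false} _ true  false = mk⇔ (λ ()) (λ ne → ⊥-elim (ne refl))
≡⇔xor-≢ {true}  {false} _ true  true  = mk⇔ (λ _ ()) (λ _ → refl)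

module _ {n : ℕ} where

  part : Fin n ⊎ Fin n → Bool
  part (inj₁ _) = false
  part (inj₂ _) = true

  inPart : Bool → Fin n → Fin n ⊎ Fin n
  inPart false = inj₁
  inPart true  = inj₂

  part-inPart : ∀ s a → part (inPart s a) ≡ s
  part-inPart false _ = refl
  part-inPart true  _ = refl

  reduce-inPart : ∀ s a → reduce (inPart s a) ≡ a
  reduce-inPart false _ = refl
  reduce-inPart true  _ = refl

  inPart-part : ∀ v → inPart (part v) (reduce v) ≡ v
  inPart-part (inj₁ _) = refl
  inPart-part (inj₂ _) = refl

  KAdj-inPart : ∀ s s′ a a′ → KAdj n (inPart s a) (inPart s′ a′) ⇔ (s ≢ s′)
  KAdj-inPart false false _ _ = mk⇔ (λ ()) (λ ne → ⊥-elim (ne refl))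
  KAdj-inPart false true  _ _ = mk⇔ (λ _ ()) (λ _ → tt)
  KAdj-inPart true  false _ _ = mk⇔ (λ _ ()) (λ _ → tt)
  KAdj-inPart true  true  _ _ = mk⇔ (λ ()) (λ ne → ⊥-elim (ne refl))

bipartite⇒copies-blowup≅K⊗ : ∀ {G} → Bipartite G → ∀ n → Copies Bool (Blowup n G) ≅ (K n ⊗ G)
bipartite⇒copies-blowup≅K⊗ {G} (c , proper) n = record
  { vertices  = mk↔ₛ′ to from to∘from from∘to
  ; adjacency = adjacency
  }
  where
  to : (Fin n × V G) × Bool → (Fin n ⊎ Fin n) × V G
  to ((a , g) , b) = inPart (b xor c g) a , g
  from : (Fin n ⊎ Fin n) × V G → (Fin n × V G) × Bool
  from (v , g) = (reduce v , g) , part v xor c g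
  to∘from : ∀ v → to (from v) ≡ v
  to∘from (v , g) = cong (_, g) (trans (cong (λ s → inPart s (reduce v)) (xor-cancelʳ (part v) (c g))) (inPart-part v))
  from∘to : ∀ u → from (to u) ≡ u
  from∘to ((a , g) , b) = cong₂ _,_ (cong (_, g) (reduce-inPart (b xor c g) a))
                                   (trans (cong (_xor c g) (part-inPart (b xor c g) a)) (xor-cancelʳ b (c g)))
  adjacency : ∀ u v → Adj (Copies Bool (Blowup n G)) u v ⇔ Adj (K n ⊗ G) (to u) (to v)
  adjacency ((a , g) , b) ((a′ , g′) , b′) = mk⇔
    (λ (b≡b′ , g~g′) → Equivalence.from (KAdj-inPart _ _ a a′) (Equivalence.to (parts g~g′) b≡b′) , g~g′)
    (λ (k , g~g′) → Equivalence.from (parts g~g′) (Equivalence.to (KAdj-inPart _ _ a a′) k) , g~g′)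
    where
    parts : Adj G g g′ → b ≡ b′ ⇔ (b xor c g ≢ b′ xor c g′)
    parts g~g′ = ≡⇔xor-≢ (proper g g′ g~g′) b b′

theorem7 : (G : Graph) → Circulant G → Bipartite G →
           (n : ℕ) → n ≥ 1 → Circulant (K n ⊗ G)
theorem7 G circulant bipartite n _ =
  circulant-≅ (bipartite⇒copies-blowup≅K⊗ bipartite n)
              (copies-circulant 2↔Bool (Blowup n G) (blowup-circulant n G circulant))
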